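{- For every constant specification $CS$ for $\mathcal{GJ}_0$: $(Th_{\mathcal{GJ}_{CS}})^\circ\subsetneq Th_{\mathcal{GK}_\Box}$.
   Context: Justification terms $Jt$ are generated by $t::= c\mid x\mid [t+t]\mid [t\cdot t]\mid\, !t\mid\, ?t$, where $c$ ranges over constants $C=\{c_i\mid i\in\mathbb{N}\}$ and $x$ over variables $V=\{x_i\}$. The language $\mathcal{L}_J$ is $\phi::=\bot\mid p\mid(\phi\rightarrow\phi)\mid(\phi\land\phi)\mid t:\phi$ with $p\in Var=\{p_i\mid i\in\mathbb{N}\}$; $\neg\phi:=\phi\rightarrow\bot$. The modal language $\mathcal{L}_\Box$ is $\phi::=\bot\mid p\mid(\phi\land\phi)\mid(\phi\rightarrow\phi)\mid\Box\phi$. The calculus $\mathcal{G}$ has the axiom schemes (A1) $(\phi\rightarrow\psi)\rightarrow((\psi\rightarrow\chi)\rightarrow(\phi\rightarrow\chi))$; (A2) $(\phi\land\psi)\rightarrow\phi$; (A3) $(\phi\land\psi)\rightarrow(\psi\land\phi)$; (A5a) $(\phi\rightarrow(\psi\rightarrow\chi))\rightarrow((\phi\land\psi)\rightarrow\chi)$; (A5b) $((\phi\land\psi)\rightarrow\chi)\rightarrow(\phi\rightarrow(\psi\rightarrow\chi))$; (A6) $((\phi\rightarrow\psi)\rightarrow\chi)\rightarrow(((\psi\rightarrow\phi)\rightarrow\chi)\rightarrow\chi)$; (A7) $\bot\rightarrow\phi$; (G4) $\phi\rightarrow(\phi\land\phi)$; and the rule (MP): from $\phi\rightarrow\psi$ and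 $\phi$ infer $\psi$. $\mathcal{GJ}_0$ is $\mathcal{G}$ over $\mathcal{L}_J$ plus (J) $t:(\phi\rightarrow\psi)\rightarrow(s:\phi\rightarrow[t\cdot s]:\psi)$ and (+) $t:\phi\rightarrow[t+s]:\phi$, $s:\phi\rightarrow[t+s]:\phi$. A constant specification for $\mathcal{GJ}_0$ is a set $CS$ of formulas $c_{i_n}:\dots:c_{i_1}:\phi$ ($n\ge1$, $c_{i_k}\in C$, $\phi$ an axiom instance of $\mathcal{GJ}_0$) such that whenever $c_{i_n}:\dots:c_{i_1}:\phi\in CS$, also $c_{i_k}:\dots:c_{i_1}:\phi\in CS$ for all $k\le n$. $\mathcal{GJ}_{CS}$ is $\mathcal{GJ}_0$ plus the rule: from $c:\phi\in CS$ infer $c:\phi$. $\mathcal{GK}_\Box$ over $\mathcal{L}_\Box$ consists of the axiom schemes of $\mathcal{G}$, (K) $\Box(\phi\rightarrow\psi)\rightarrow(\Box\phi\rightarrow\Box\psi)$, (Z) $\neg\neg\Box\phi\rightarrow\Box\neg\neg\phi$, the rule (MP), and the rule (N$\Box$): from a theorem $\phi$ infer $\Box\phi$. For a proof system $\mathcal{S}$ over a language $\mathcal{L}$, $Th_\mathcal{S}=\{\phi\in\mathcal{L}\mid\ \vdash_\mathcal{S}\phi\}$. The forgetful projection $\circ:\mathcal{L}_J\to\mathcal{L}_\Box$ is given by $p^\circ=p$, $\bot^\circ=\bot$, $(\phi\land\psi)^\circ=\phi^\circ\land\psi^\circ$, $(\phi\rightarrow\psi)^\circ=\phi^\circ\rightarrow\psi^\circ$,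 $(t:\phi)^\circ=\Box\phi^\circ$, and $\Gamma^\circ=\{\phi^\circ\mid\phi\in\Gamma\}$. -}

module Defs where

open import Data.Nat using (ℕ)
open import Data.List using (List; []; _∷_; _++_)
open import Data.Product using (Σ; _×_; ∃; _,_)
open import Relation.Binary.PropositionalEquality using (_≡_)
open import Relation.Nullary using (¬_)

data Tm : Set where
  cst  : ℕ → Tm
  var  : ℕ → Tm
  _⊕_  : Tm → Tm → Tm
  _⊙_  : Tm → Tm → Tm
  !_   : Tm → Tm
  ??_  : Tm → Tm

infixr 5 _⇒_
infixr 6 _∧_
infixr 7 _∶_

data FmJ : Set where
  ⊥J   : FmJ
  pv   : ℕ → FmJ
  _⇒_  : FmJ → FmJ → FmJ
  _∧_  : FmJ → FmJ → FmJ
  _∶_  : Tm → FmJ → FmJ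

¬J : FmJ → FmJ
¬J φ = φ ⇒ ⊥J

infixr 5 _⇒ᵇ_
infixr 6 _∧ᵇ_

data FmB : Set where
  ⊥B    : FmB
  pb    : ℕ → FmB
  _∧ᵇ_  : FmB → FmB → FmB
  _⇒ᵇ_  : FmB → FmB → FmB
  □_    : FmB → FmB

¬B : FmB → FmB
¬B φ = φ ⇒ᵇ ⊥B

-- Axiom instances of GJ_0 (axioms of G over L_J, plus (J) and (+))

data AxJ : FmJ → Set where
  A1  : ∀ φ ψ χ → AxJ ((φ ⇒ ψ) ⇒ ((ψ ⇒ χ) ⇒ (φ ⇒ χ)))
  A2  : ∀ φ ψ → AxJ ((φ ∧ ψ) ⇒ φ)
  A3  : ∀ φ ψ → AxJ ((φ ∧ ψ) ⇒ (ψ ∧ φ))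
  A5a : ∀ φ ψ χ → AxJ ((φ ⇒ (ψ ⇒ χ)) ⇒ ((φ ∧ ψ) ⇒ χ))
  A5b : ∀ φ ψ χ → AxJ (((φ ∧ ψ) ⇒ χ) ⇒ (φ ⇒ (ψ ⇒ χ)))
  A6  : ∀ φ ψ χ → AxJ (((φ ⇒ ψ) ⇒ χ) ⇒ (((ψ ⇒ φ) ⇒ χ) ⇒ χ))
  A7  : ∀ φ → AxJ (⊥J ⇒ φ)
  G4  : ∀ φ → AxJ (φ ⇒ (φ ∧ φ))
  AJ  : ∀ t s φ ψ → AxJ ((t ∶ (φ ⇒ ψ)) ⇒ ((s ∶ φ) ⇒ ((t ⊙ s) ∶ ψ)))
  A+l : ∀ t s φ → AxJ ((t ∶ φ) ⇒ ((t ⊕ s) ∶ φ))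
  A+r : ∀ t s φ → AxJ ((s ∶ φ) ⇒ ((t ⊕ s) ∶ φ))

chain : List ℕ → FmJ → FmJ
chain []       φ = φ
chain (c ∷ cs) φ = cst c ∶ chain cs φ

record ConstSpec : Set₁ where
  field
    CS     : FmJ → Set
    shape  : ∀ ψ → CS ψ →
             Σ ℕ λ c → Σ (List ℕ) λ cs → Σ FmJ λ φ →
               AxJ φ × (ψ ≡ chain (c ∷ cs) φ)
    closed : ∀ (cs₁ : List ℕ) (c : ℕ) (cs₂ : List ℕ) (φ : FmJ) → AxJ φ →
             CS (chain (cs₁ ++ (c ∷ cs₂)) φ) → CS (chain (c ∷ cs₂) φ)

open ConstSpec public

data _⊢J_ (cs : ConstSpec) : FmJ → Set where
  ax  : ∀ {φ} → AxJ φ → cs ⊢J φ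
  mp  : ∀ {φ ψ} → cs ⊢J (φ ⇒ ψ) → cs ⊢J φ → cs ⊢J ψ
  csr : ∀ {φ} → CS cs φ → cs ⊢J φ

data AxB : FmB → Set where
  A1  : ∀ φ ψ χ → AxB ((φ ⇒ᵇ ψ) ⇒ᵇ ((ψ ⇒ᵇ χ) ⇒ᵇ (φ ⇒ᵇ χ)))
  A2  : ∀ φ ψ → AxB ((φ ∧ᵇ ψ) ⇒ᵇ φ)
  A3  : ∀ φ ψ → AxB ((φ ∧ᵇ ψ) ⇒ᵇ (ψ ∧ᵇ φ))
  A5a : ∀ φ ψ χ → AxB ((φ ⇒ᵇ (ψ ⇒ᵇ χ)) ⇒ᵇ ((φ ∧ᵇ ψ) ⇒ᵇ χ))
  A5b : ∀ φ ψ χ → AxB (((φ ∧ᵇ ψ) ⇒ᵇ χ) ⇒ᵇ (φ ⇒ᵇ (ψ ⇒ᵇ χ)))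
  A6  : ∀ φ ψ χ → AxB (((φ ⇒ᵇ ψ) ⇒ᵇ χ) ⇒ᵇ (((ψ ⇒ᵇ φ) ⇒ᵇ χ) ⇒ᵇ χ))
  A7  : ∀ φ → AxB (⊥B ⇒ᵇ φ)
  G4  : ∀ φ → AxB (φ ⇒ᵇ (φ ∧ᵇ φ))
  K   : ∀ φ ψ → AxB ((□ (φ ⇒ᵇ ψ)) ⇒ᵇ ((□ φ) ⇒ᵇ (□ ψ)))
  Z   : ∀ φ → AxB (¬B (¬B (□ φ)) ⇒ᵇ (□ (¬B (¬B φ))))

data ⊢GK : FmB → Set where
  ax  : ∀ {φ} → AxB φ → ⊢GK φ
  mp  : ∀ {φ ψ} → ⊢GK (φ ⇒ᵇ ψ) → ⊢GK φ → ⊢GK ψ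
  nec : ∀ {φ} → ⊢GK φ → ⊢GK (□ φ)

_° : FmJ → FmB
⊥J ° = ⊥B
pv p ° = pb p
(φ ⇒ ψ) ° = (φ °) ⇒ᵇ (ψ °)
(φ ∧ ψ) ° = (φ °) ∧ᵇ (ψ °)
(t ∶ φ) ° = □ (φ °)

ThGJ : ConstSpec → FmJ → Set
ThGJ cs φ = cs ⊢J φ

ThGK : FmB → Set
ThGK = ⊢GK

ThGJ° : ConstSpec → FmB → Set
ThGJ° cs ψ = Σ FmJ λ φ → ThGJ cs φ × (φ ° ≡ ψ)

_⊊_ : (FmB → Set) → (FmB → Set) → Set
P ⊊ Q = (∀ ψ → P ψ → Q ψ) × (Σ FmB λ ψ → Q ψ × ¬ P ψ)

module Submission where

-- Projecting a GJ_CS-derivation gives a GK_□-derivation: the propositional axioms project to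
-- themselves, (J) to (K), (+) to instances of φ → φ, and the members c_n:…:c_1:φ of CS to
-- n-fold necessitations of an axiom.
--
-- The instance ¬¬□p → □¬¬p of (Z) has no GJ_CS-theorem as preimage.  Its preimages are the
-- formulas ¬¬t:p → s:¬¬p, and every GJ_CS-theorem holds at the root of a Fitting model on two
-- worlds root ≤ leaf whose evidence function is the least one generated by CS.  With p false
-- at the root and true at the leaf, ¬¬t:p holds at the root; but s:¬¬p would need s to be
-- evidence for ¬¬p, which is impossible because all evidenced formulas hold at the root of
-- the model in which p is false at the leaf too.  The metatheory is constructive, so truth at
-- the root is only established under double negation: prelinearity (A6) is true on a linear
-- frame by a case analysis on truth values.

open import Defs
open import Data.Nat using (ℕ)
open import Data.List using ([]; _∷_; _++_; _∷ʳ_)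
open import Data.List.Properties using (∷ʳ-++)
open import Data.Product using (∃₂; _×_; _,_; proj₁; proj₂; swap; curry; uncurry)
import Data.Product as Product
open import Data.Sum using (_⊎_; inj₁; inj₂; [_,_]′)
import Data.Sum as Sum
open import Data.Empty using (⊥; ⊥-elim)
open import Data.Unit using (⊤; tt)
open import Function using (_∘_; const; id)
open import Relation.Binary.PropositionalEquality using (_≡_; refl; sym; subst)
open import Relation.Nullary using (¬_; Dec; yes; no)
open import Relation.Nullary.Decidable using (¬¬-excluded-middle)
open import Relation.Nullary.Negation using (DoubleNegation; ¬¬-Monad; contradiction)
open import Effect.Monad using (RawMonad)
open import Level using (0ℓ)

open RawMonad (¬¬-Monad {0ℓ}) using (pure; _<$>_; _>>=_)

⊢GK-id : ∀ φ → ⊢GK (φ ⇒ᵇ φ)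
⊢GK-id φ = mp (mp (ax (A1 φ (φ ∧ᵇ φ) φ)) (ax (G4 φ))) (ax (A2 φ φ))

AxJ°-provable : ∀ {φ} → AxJ φ → ⊢GK (φ °)
AxJ°-provable (A1 φ ψ χ)   = ax (A1 _ _ _)
AxJ°-provable (A2 φ ψ)     = ax (A2 _ _)
AxJ°-provable (A3 φ ψ)     = ax (A3 _ _)
AxJ°-provable (A5a φ ψ χ)  = ax (A5a _ _ _)
AxJ°-provable (A5b φ ψ χ)  = ax (A5b _ _ _)
AxJ°-provable (A6 φ ψ χ)   = ax (A6 _ _ _)
AxJ°-provable (A7 φ)       = ax (A7 _)
AxJ°-provable (G4 φ)       = ax (G4 _)
AxJ°-provable (AJ t s φ ψ) = ax (K _ _)
AxJ°-provable (A+l t s φ)  = ⊢GK-id _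
AxJ°-provable (A+r t s φ)  = ⊢GK-id _

chain°-provable : ∀ cs φ → ⊢GK (φ °) → ⊢GK (chain cs φ °)
chain°-provable []       φ ⊢φ° = ⊢φ°
chain°-provable (c ∷ cs) φ ⊢φ° = nec (chain°-provable cs φ ⊢φ°)

°-sound : ∀ {C φ} → C ⊢J φ → ⊢GK (φ °)
°-sound (ax a)   = AxJ°-provable a
°-sound (mp d e) = mp (°-sound d) (°-sound e)
°-sound {C} {φ} (csr m) with shape C φ m
... | c , cs , ψ , a , refl = chain°-provable (c ∷ cs) ψ (AxJ°-provable a)

data Evidence (C : ConstSpec) : Tm → FmJ → Set where
  spec : ∀ {c φ} → CS C (cst c ∶ φ) → Evidence C (cst c) φ
  app  : ∀ {t s φ ψ} → Evidence C t (φ ⇒ ψ) → Evidence C s φ → Evidence C (t ⊙ s) ψ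
  sumˡ : ∀ {t s φ} → Evidence C t φ → Evidence C (t ⊕ s) φ
  sumʳ : ∀ {t s φ} → Evidence C s φ → Evidence C (t ⊕ s) φ

module TwoWorldModel (C : ConstSpec) (Rootᵖ Leafᵖ : ℕ → Set)
                     (persistᵖ : ∀ {n} → Rootᵖ n → Leafᵖ n) where

  Leaf : FmJ → Set
  Leaf ⊥J      = ⊥
  Leaf (pv n)  = Leafᵖ n
  Leaf (φ ⇒ ψ) = Leaf φ → Leaf ψ
  Leaf (φ ∧ ψ) = Leaf φ × Leaf ψ
  Leaf (t ∶ φ) = Leaf φ

  Root : FmJ → Set
  Root ⊥J      = ⊥
  Root (pv n)  = Rootᵖ n
  Root (φ ⇒ ψ) = (Root φ → Root ψ) × (Leaf φ → Leaf ψ)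
  Root (φ ∧ ψ) = Root φ × Root ψ
  Root (t ∶ φ) = Evidence C t φ × Root φ

  persist : ∀ φ → Root φ → Leaf φ
  persist ⊥J      ()
  persist (pv n)  = persistᵖ
  persist (φ ⇒ ψ) = proj₂
  persist (φ ∧ ψ) = Product.map (persist φ) (persist ψ)
  persist (t ∶ φ) = persist φ ∘ proj₂

  implication-from-false : ∀ φ ψ → ¬ Leaf φ → Root (φ ⇒ ψ)
  implication-from-false φ ψ ¬φ = (λ rφ → contradiction (persist φ rφ) ¬φ) , (λ lφ → contradiction lφ ¬φ)

  root-linear : ∀ φ ψ → Dec (Leaf φ) → Dec (Leaf ψ) → Dec (Root φ) → Root (φ ⇒ ψ) ⊎ Root (ψ ⇒ φ)
  root-linear φ ψ (no ¬lφ) _        _        = inj₁ (implication-from-false φ ψ ¬lφ)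
  root-linear φ ψ _        (no ¬lψ) _        = inj₂ (implication-from-false ψ φ ¬lψ)
  root-linear φ ψ (yes lφ) (yes lψ) (no ¬rφ) = inj₁ ((λ rφ → contradiction rφ ¬rφ) , const lψ)
  root-linear φ ψ (yes lφ) (yes lψ) (yes rφ) = inj₂ (const rφ , const lφ)

  ¬¬-root-linear : ∀ φ ψ → DoubleNegation (Root (φ ⇒ ψ) ⊎ Root (ψ ⇒ φ))
  ¬¬-root-linear φ ψ = do
    lφ? ← ¬¬-excluded-middle
    lψ? ← ¬¬-excluded-middle
    rφ? ← ¬¬-excluded-middle
    pure (root-linear φ ψ lφ? lψ? rφ?)

  prelinearity : ∀ φ ψ χ → Root (φ ⇒ ψ) ⊎ Root (ψ ⇒ φ) →
                 Root (((φ ⇒ ψ) ⇒ χ) ⇒ (((ψ ⇒ φ) ⇒ χ) ⇒ χ))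
  prelinearity φ ψ χ linear =
      (λ (h , hˡ) → (λ (k , kˡ) → [ h , k ]′ linear) , (λ kˡ → [ hˡ , kˡ ]′ linearˡ))
    , (λ hˡ kˡ → [ hˡ , kˡ ]′ linearˡ)
    where
    linearˡ : Leaf (φ ⇒ ψ) ⊎ Leaf (ψ ⇒ φ)
    linearˡ = Sum.map proj₂ proj₂ linear

  axiom-root : ∀ {φ} → AxJ φ → DoubleNegation (Root φ)
  axiom-root (A1 φ ψ χ)   = pure ((λ (f , fˡ) → (λ (g , gˡ) → g ∘ f , gˡ ∘ fˡ) , (λ gˡ → gˡ ∘ fˡ))
                                 , (λ fˡ gˡ → gˡ ∘ fˡ))
  axiom-root (A2 φ ψ)     = pure (proj₁ , proj₁)
  axiom-root (A3 φ ψ)     = pure (swap , swap)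
  axiom-root (A5a φ ψ χ)  = pure ((λ (f , fˡ) → uncurry (proj₁ ∘ f) , uncurry fˡ) , uncurry)
  axiom-root (A5b φ ψ χ)  = pure ((λ (f , fˡ) → (λ x → curry f x , curry fˡ (persist φ x)) , curry fˡ)
                                 , curry)
  axiom-root (A6 φ ψ χ)   = prelinearity φ ψ χ <$> ¬¬-root-linear φ ψ
  axiom-root (A7 φ)       = pure (⊥-elim , ⊥-elim)
  axiom-root (G4 φ)       = pure ((λ x → x , x) , (λ x → x , x))
  axiom-root (AJ t s φ ψ) = pure ((λ (e , f , fˡ) → (λ (e′ , x) → app e e′ , f x) , fˡ) , id)
  axiom-root (A+l t s φ)  = pure (Product.map₁ sumˡ , id)
  axiom-root (A+r t s φ)  = pure (Product.map₁ sumʳ , id)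

  spec-root : ∀ cs₁ cs₂ φ → AxJ φ → CS C (chain (cs₁ ++ cs₂) φ) → DoubleNegation (Root (chain cs₂ φ))
  spec-root cs₁ []        φ a m = axiom-root a
  spec-root cs₁ (c ∷ cs₂) φ a m = (spec (closed C cs₁ c cs₂ φ a m) ,_) <$> spec-root (cs₁ ∷ʳ c) cs₂ φ a m′
    where
    m′ : CS C (chain (cs₁ ∷ʳ c ++ cs₂) φ)
    m′ = subst (λ cs → CS C (chain cs φ)) (sym (∷ʳ-++ cs₁ c cs₂)) m

  CS-root : ∀ {φ} → CS C φ → DoubleNegation (Root φ)
  CS-root {φ} m with shape C φ m
  ... | c , cs , ψ , a , refl = spec-root [] (c ∷ cs) ψ a m

  sound : ∀ {φ} → C ⊢J φ → DoubleNegation (Root φ)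
  sound (ax a)   = axiom-root a
  sound (mp d e) = do (f , _) ← sound d ; f <$> sound e
  sound (csr m)  = CS-root m

  evidence-root : ∀ {t φ} → Evidence C t φ → DoubleNegation (Root φ)
  evidence-root (spec m)  = proj₂ <$> CS-root m
  evidence-root (app e f) = do (g , _) ← evidence-root e ; g <$> evidence-root f
  evidence-root (sumˡ e)  = evidence-root e
  evidence-root (sumʳ e)  = evidence-root e

no-evidence-for-¬¬p : ∀ C s n → ¬ Evidence C s (¬J (¬J (pv n)))
no-evidence-for-¬¬p C s n e = evidence-root e (λ (_ , ¬¬p-at-leaf) → ¬¬p-at-leaf id)
  where open TwoWorldModel C (const ⊥) (const ⊥) id

Z-realisation : Tm → Tm → ℕ → FmJ
Z-realisation t s n = ¬J (¬J (t ∶ pv n)) ⇒ (s ∶ ¬J (¬J (pv n)))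

Z-realisation-unprovable : ∀ C t s n → ¬ (C ⊢J Z-realisation t s n)
Z-realisation-unprovable C t s n ⊢Z =
  sound ⊢Z (λ (Z-at-root , _) → no-evidence-for-¬¬p C s n (proj₁ (Z-at-root ¬¬tp-at-root)))
  where
  open TwoWorldModel C (const ⊥) (const ⊤) (const tt)
  ¬¬tp-at-root : Root (¬J (¬J (t ∶ pv n)))
  ¬¬tp-at-root = (λ (_ , ¬tp-at-leaf) → ¬tp-at-leaf tt) , (λ ¬tp-at-leaf → ¬tp-at-leaf tt)

infixr 5 _⇒ᶠ_
infixr 6 _∧ᶠ_
infixr 7 □ᶠ_

-- The graph of _°, so that preimages under _° can be computed by pattern matching.
data Forgets : FmJ → FmB → Set where
  ⊥ᶠ   : Forgets ⊥J ⊥B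
  pᶠ   : ∀ {n} → Forgets (pv n) (pb n)
  _⇒ᶠ_ : ∀ {φ ψ A B} → Forgets φ A → Forgets ψ B → Forgets (φ ⇒ ψ) (A ⇒ᵇ B)
  _∧ᶠ_ : ∀ {φ ψ A B} → Forgets φ A → Forgets ψ B → Forgets (φ ∧ ψ) (A ∧ᵇ B)
  □ᶠ_  : ∀ {t φ A} → Forgets φ A → Forgets (t ∶ φ) (□ A)

forgets : ∀ φ → Forgets φ (φ °)
forgets ⊥J      = ⊥ᶠ
forgets (pv n)  = pᶠ
forgets (φ ⇒ ψ) = forgets φ ⇒ᶠ forgets ψ
forgets (φ ∧ ψ) = forgets φ ∧ᶠ forgets ψ
forgets (t ∶ φ) = □ᶠ forgets φ

Z-instance : ℕ → FmB
Z-instance n = ¬B (¬B (□ pb n)) ⇒ᵇ (□ (¬B (¬B (pb n))))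

Z-preimage : ∀ {φ n} → Forgets φ (Z-instance n) → ∃₂ λ t s → φ ≡ Z-realisation t s n
Z-preimage (((□ᶠ pᶠ ⇒ᶠ ⊥ᶠ) ⇒ᶠ ⊥ᶠ) ⇒ᶠ □ᶠ ((pᶠ ⇒ᶠ ⊥ᶠ) ⇒ᶠ ⊥ᶠ)) = _ , _ , refl

Z-instance-not-projected : ∀ C n → ¬ ThGJ° C (Z-instance n)
Z-instance-not-projected C n (φ , ⊢φ , φ°≡Z) with Z-preimage (subst (Forgets φ) φ°≡Z (forgets φ))
... | t , s , refl = Z-realisation-unprovable C t s n ⊢φ

mainTheorem4 : (cs : ConstSpec) → ThGJ° cs ⊊ ThGK
mainTheorem4 cs = (λ { _ (φ , ⊢φ , refl) → °-sound ⊢φ })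
                , Z-instance 0 , ax (Z (pb 0)) , Z-instance-not-projected cs 0
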